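{- Let $\mathcal{F}\subset\mathbb{Z}^d$ and $\mathcal{M}\subset\mathbb{Z}^d$ be finite and let $\mathcal{F}_i:=(i\cdot\operatorname{conv}(\mathcal{F}))\cap\mathbb{Z}^d$ for $i\in\mathbb{N}$. For all $u,v\in\mathcal{F}$ and all $i\in\mathbb{N}$, $\operatorname{dist}_{\mathcal{F}_i^c(\mathcal{M})}(iu,iv)\le\operatorname{dist}_{\mathcal{F}(\mathcal{M})}(u,v)$.
   Context: For finite $\mathcal{G},\mathcal{N}\subset\mathbb{Z}^d$, $\mathcal{G}(\mathcal{N})$ is the graph on $\mathcal{G}$ where $u,v$ are adjacent iff $u-v\in\mathcal{N}$ or $v-u\in\mathcal{N}$; its compression is $\mathcal{G}^c(\mathcal{N}):=\mathcal{G}(\{\lambda n:\lambda\in\mathbb{Z},n\in\mathcal{N}\})$. $\operatorname{dist}_G(u,v)$ is the graph distance in $G$, equal to $\infty$ if $u,v$ are disconnected. $\operatorname{conv}$ denotes convex hull. -}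

module Defs where

open import Data.Nat using (ℕ; zero; suc; _≤_)
open import Data.Integer using (ℤ; +_) renaming (_-_ to _-ℤ_; _*_ to _*ℤ_)
open import Data.Rational using (ℚ; 0ℚ; 1ℚ) renaming (_+_ to _+ℚ_; _*_ to _*ℚ_; _≤_ to _≤ℚ_; _/_ to _/ℚ_)
open import Data.Vec using (Vec; map; zipWith; replicate)
open import Data.List using (List; []; _∷_; length; foldr)
open import Data.List.Membership.Propositional using (_∈_)
open import Data.List.Relation.Unary.All using (All)
open import Data.Product using (Σ; ∃; _×_; _,_)
open import Data.Sum using (_⊎_)
open import Relation.Binary.PropositionalEquality using (_≡_)

-- Points of ℤ^d.  Finite subsets of ℤ^d are given as lists of points.
Pt : ℕ → Set
Pt d = Vec ℤ d

_⊖_ : ∀ {d} → Pt d → Pt d → Pt d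
u ⊖ v = zipWith _-ℤ_ u v

_⊙_ : ∀ {d} → ℤ → Pt d → Pt d
k ⊙ u = map (k *ℤ_) u

toℚ : ∀ {d} → Pt d → Vec ℚ d
toℚ = map (λ z → z /ℚ 1)

combo : ∀ {d} → List (Pt d) → List ℚ → Vec ℚ d
combo (f ∷ fs) (l ∷ ls) = zipWith _+ℚ_ (map (l *ℚ_) (toℚ f)) (combo fs ls)
combo _ _ = replicate _ 0ℚ

sumℚ : List ℚ → ℚ
sumℚ = foldr _+ℚ_ 0ℚ

InScaledHull : ∀ {d} → ℕ → List (Pt d) → Pt d → Set
InScaledHull i F x =
  Σ (List ℚ) λ ls →
    (length ls ≡ length F) × All (0ℚ ≤ℚ_) ls × (sumℚ ls ≡ 1ℚ) ×
    (toℚ x ≡ map (((+ i) /ℚ 1) *ℚ_) (combo F ls))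

record Graph (d : ℕ) : Set₁ where
  field
    Vert : Pt d → Set
    Adj  : Pt d → Pt d → Set
open Graph public

data Walk {d} (G : Graph d) : Pt d → Pt d → ℕ → Set where
  here : ∀ {u} → Vert G u → Walk G u u zero
  step : ∀ {u w v n} → Vert G u → Adj G u w → Walk G w v n → Walk G u v (suc n)

-- dist_H(a,b) ≤ dist_G(u,v)  (with dist = ∞ for disconnected pairs):
-- every walk u→v in G of length n yields a walk a→b in H of length ≤ n.
DistLe : ∀ {d} → Graph d → Pt d → Pt d → Graph d → Pt d → Pt d → Set
DistLe H a b G u v =
  ∀ n → Walk G u v n → ∃ λ m → m ≤ n × Walk H a b m

NGraph : ∀ {d} → List (Pt d) → List (Pt d) → Graph d
NGraph G N = record
  { Vert = λ x → x ∈ G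
  ; Adj  = λ u v → ((u ⊖ v) ∈ N) ⊎ ((v ⊖ u) ∈ N) }

-- 𝒢^c(𝒩) for a vertex set given by a predicate: u ~ v iff u - v = λ n (λ ∈ ℤ, n ∈ 𝒩)
-- (this relation is already symmetric, taking -λ).
CGraph : ∀ {d} → (Pt d → Set) → List (Pt d) → Graph d
CGraph V N = record
  { Vert = V
  ; Adj  = λ u v → Σ ℤ λ k → Σ (Pt _) λ n → (n ∈ N) × (u ⊖ v ≡ k ⊙ n) }

Fi : ∀ {d} → ℕ → List (Pt d) → Pt d → Set
Fi i F = InScaledHull i F

module Submission where

open import Defs
open import Data.Nat using (ℕ; zero; suc)
open import Data.Nat.Properties using (≤-refl)
open import Data.Nat.Coprimality using (1-coprimeTo; sym)
open import Data.Integer using (ℤ; +_; -[1+_]; -_) renaming (_-_ to _-ℤ_; _*_ to _*ℤ_)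
open import Data.Integer.Tactic.RingSolver using (solve-∀)
open import Data.Rational using (ℚ; 0ℚ; 1ℚ; mkℚ) renaming (_+_ to _+ℚ_; _*_ to _*ℚ_; _≤_ to _≤ℚ_; _/_ to _/ℚ_)
import Data.Rational as ℚ
import Data.Rational.Properties as ℚ
open import Data.Vec using (Vec; []; _∷_; map; zipWith)
import Data.Vec as Vec
open import Data.List using (List; []; _∷_; length; replicate)
open import Data.List.Properties using (length-replicate)
open import Data.List.Membership.Propositional using (_∈_)
open import Data.List.Relation.Unary.Any using (here; there)
open import Data.List.Relation.Unary.All using (All; _∷_)
open import Data.List.Relation.Unary.All.Properties using (replicate⁺)
open import Data.Product using (_,_)
open import Data.Sum using (inj₁; inj₂)
open import Relation.Binary.PropositionalEquality using (_≡_; refl; cong; cong₂; trans)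
import Relation.Binary.PropositionalEquality as Eq

-- Multiplication by i maps 𝓕(𝓜) into 𝓕ᵢᶜ(𝓜): a vertex f goes to i·f, which lies in
-- i·conv(𝓕) via the convex combination putting weight 1 on f, and an edge difference
-- ±m goes to ±i·m, an integer multiple of m.  Walks therefore map to walks of the
-- same length.

/1≡mkℚ : ∀ z → z /ℚ 1 ≡ mkℚ z 0 (sym (1-coprimeTo _))
/1≡mkℚ (+ n)    = ℚ.normalize-coprime (sym (1-coprimeTo n))
/1≡mkℚ -[1+ n ] = cong ℚ.-_ (ℚ.normalize-coprime (sym (1-coprimeTo (suc n))))

*-/1-homo : ∀ a b → (a *ℤ b) /ℚ 1 ≡ (a /ℚ 1) *ℚ (b /ℚ 1)
*-/1-homo a b rewrite /1≡mkℚ a | /1≡mkℚ b = refl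

toℚ-⊙ : ∀ {d} (k : ℤ) (w : Pt d) → toℚ (k ⊙ w) ≡ map ((k /ℚ 1) *ℚ_) (toℚ w)
toℚ-⊙ k []      = refl
toℚ-⊙ k (x ∷ w) = cong₂ _∷_ (*-/1-homo k x) (toℚ-⊙ k w)

0*x+y≡y : ∀ {d} (x y : Vec ℚ d) → zipWith _+ℚ_ (map (0ℚ *ℚ_) x) y ≡ y
0*x+y≡y []      []      = refl
0*x+y≡y (a ∷ x) (b ∷ y) =
  cong₂ _∷_ (trans (cong (_+ℚ b) (ℚ.*-zeroˡ a)) (ℚ.+-identityˡ b)) (0*x+y≡y x y)

1*x+0≡x : ∀ {d} (x : Vec ℚ d) → zipWith _+ℚ_ (map (1ℚ *ℚ_) x) (Vec.replicate d 0ℚ) ≡ x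
1*x+0≡x []      = refl
1*x+0≡x (a ∷ x) =
  cong₂ _∷_ (trans (ℚ.+-identityʳ (1ℚ *ℚ a)) (ℚ.*-identityˡ a)) (1*x+0≡x x)

sumℚ-replicate-0 : ∀ n → sumℚ (replicate n 0ℚ) ≡ 0ℚ
sumℚ-replicate-0 zero    = refl
sumℚ-replicate-0 (suc n) = trans (cong (0ℚ +ℚ_) (sumℚ-replicate-0 n)) (ℚ.+-identityˡ 0ℚ)

combo-replicate-0 : ∀ {d} (F : List (Pt d)) → combo F (replicate (length F) 0ℚ) ≡ Vec.replicate d 0ℚ
combo-replicate-0 []       = refl
combo-replicate-0 (f ∷ fs) = trans (0*x+y≡y (toℚ f) _) (combo-replicate-0 fs)

indicator : ∀ {d} {w : Pt d} {F : List (Pt d)} → w ∈ F → List ℚ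
indicator {F = _ ∷ fs} (here _) = 1ℚ ∷ replicate (length fs) 0ℚ
indicator (there p)             = 0ℚ ∷ indicator p

length-indicator : ∀ {d} {w : Pt d} {F} (p : w ∈ F) → length (indicator p) ≡ length F
length-indicator {F = _ ∷ fs} (here _) = cong suc (length-replicate (length fs))
length-indicator (there p)             = cong suc (length-indicator p)

indicator-nonNeg : ∀ {d} {w : Pt d} {F} (p : w ∈ F) → All (0ℚ ≤ℚ_) (indicator p)
indicator-nonNeg {F = _ ∷ fs} (here _) = ℚ.nonNegative⁻¹ 1ℚ ∷ replicate⁺ (length fs) ℚ.≤-refl
indicator-nonNeg (there p)             = ℚ.≤-refl ∷ indicator-nonNeg p

sumℚ-indicator : ∀ {d} {w : Pt d} {F} (p : w ∈ F) → sumℚ (indicator p) ≡ 1ℚ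
sumℚ-indicator {F = _ ∷ fs} (here _) =
  trans (cong (1ℚ +ℚ_) (sumℚ-replicate-0 (length fs))) (ℚ.+-identityʳ 1ℚ)
sumℚ-indicator (there p) = trans (ℚ.+-identityˡ _) (sumℚ-indicator p)

combo-indicator : ∀ {d} {w : Pt d} {F} (p : w ∈ F) → combo F (indicator p) ≡ toℚ w
combo-indicator {F = f ∷ fs} (here refl) =
  trans (cong (zipWith _+ℚ_ (map (1ℚ *ℚ_) (toℚ f))) (combo-replicate-0 fs)) (1*x+0≡x (toℚ f))
combo-indicator {F = f ∷ fs} (there p) = trans (0*x+y≡y (toℚ f) _) (combo-indicator p)

∈⇒InScaledHull : ∀ {d} (i : ℕ) {F : List (Pt d)} {w} → w ∈ F → InScaledHull i F ((+ i) ⊙ w)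
∈⇒InScaledHull i p =
  indicator p , length-indicator p , indicator-nonNeg p , sumℚ-indicator p ,
  trans (toℚ-⊙ (+ i) _) (cong (map (((+ i) /ℚ 1) *ℚ_)) (Eq.sym (combo-indicator p)))

⊙-distribˡ-⊖ : ∀ {d} (k : ℤ) (a b : Pt d) → (k ⊙ a) ⊖ (k ⊙ b) ≡ k ⊙ (a ⊖ b)
⊙-distribˡ-⊖ k []      []      = refl
⊙-distribˡ-⊖ k (x ∷ a) (y ∷ b) = cong₂ _∷_ (*-distribˡ-- k x y) (⊙-distribˡ-⊖ k a b)
  where
  *-distribˡ-- : ∀ k x y → k *ℤ x -ℤ k *ℤ y ≡ k *ℤ (x -ℤ y)
  *-distribˡ-- = solve-∀

⊙-⊖-swap : ∀ {d} (k : ℤ) (a b : Pt d) → (k ⊙ a) ⊖ (k ⊙ b) ≡ (- k) ⊙ (b ⊖ a)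
⊙-⊖-swap k []      []      = refl
⊙-⊖-swap k (x ∷ a) (y ∷ b) = cong₂ _∷_ (*-swap-- k x y) (⊙-⊖-swap k a b)
  where
  *-swap-- : ∀ k x y → k *ℤ x -ℤ k *ℤ y ≡ (- k) *ℤ (y -ℤ x)
  *-swap-- = solve-∀

⊙-preserves-Adj : ∀ {d} (k : ℤ) (V : Pt d → Set) {F M : List (Pt d)} {u w : Pt d} →
  Adj (NGraph F M) u w → Adj (CGraph V M) (k ⊙ u) (k ⊙ w)
⊙-preserves-Adj k V {u = u} {w} (inj₁ m) = k   , u ⊖ w , m , ⊙-distribˡ-⊖ k u w
⊙-preserves-Adj k V {u = u} {w} (inj₂ m) = - k , w ⊖ u , m , ⊙-⊖-swap k u w

map-Walk : ∀ {d} {G H : Graph d} (f : Pt d → Pt d) →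
  (∀ {x} → Vert G x → Vert H (f x)) → (∀ {x y} → Adj G x y → Adj H (f x) (f y)) →
  ∀ {u v n} → Walk G u v n → Walk H (f u) (f v) n
map-Walk f vert adj (here p)       = here (vert p)
map-Walk f vert adj (step p e wk) = step (vert p) (adj e) (map-Walk f vert adj wk)

lemma3p14 : ∀ {d : ℕ} (F M : List (Pt d)) (u v : Pt d) → u ∈ F → v ∈ F → (i : ℕ) →
    DistLe (CGraph (Fi i F) M) ((+ i) ⊙ u) ((+ i) ⊙ v) (NGraph F M) u v
lemma3p14 F M u v _ _ i n wk =
  n , ≤-refl , map-Walk ((+ i) ⊙_) (∈⇒InScaledHull i) (⊙-preserves-Adj (+ i) (Fi i F) {F}) wk
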